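{- Let $p,h,k$ be positive integers, $\beta\in I_{(h,k)}$ and $\rho\in\mathcal P_{(p,h,k),\beta}$. Let $J\triangleleft\mathbf k[x_1,x_2,x_3]$ be the monomial ideal whose set of terms not in $J$ is $\mathsf N_\rho=\{x_1^{a}x_2^{j-1}x_3^{i-1} : 1\le i\le k,\ 1\le j\le\beta_i,\ 0\le a\le\rho_{i,j}-1\}$. Then the star set of $J$ is $\mathcal F(J)=\{x_3^k\}\cup\{x_2^{\beta_i}x_3^{i-1} : 1\le i\le k\}\cup\{x_1^{\rho_{i,j}}x_2^{j-1}x_3^{i-1} : 1\le i\le k,\ 1\le j\le\beta_i\}$.
   Context: $I_{(h,k)}$ is the set of $(\beta_1,\dots,\beta_k)\in\mathbb N^k$ with $\beta_1>\dots>\beta_k>0$ and $\sum\beta_i=h$. $\mathcal P_{(p,h,k),\beta}$ is the set of integer arrays $\rho=(\rho_{i,j})_{1\le i\le k,\,1\le j\le\beta_i}$ with $\rho_{i,j}>0$, $\rho_{i,j}>\rho_{i,j+1}$ (for $j<\beta_i$), $\rho_{i,j}>\rho_{i+1,j}$ (for $i<k$, $j\le\beta_{i+1}$), and $\sum\rho_{i,j}=p$; for such $\rho$ the set $\mathsf N_\rho$ is an order ideal, so $J$ is well defined. Variables are ordered $x_1<x_2<x_3$; $\min(\tau)$ is the smallest variable dividing a term $\tau$. The star set of a monomial ideal $J$ is $\mathcal F(J)=\{x^\gamma\notin\mathsf N(J) : x^\gamma/\min(x^\gamma)\in\mathsf N(J)\}$, where $\mathsf N(J)$ is the set of terms not in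 $J$. -}

module Defs where

open import Data.Nat using (ℕ; zero; suc; _+_; _<_)
open import Data.Product using (_×_; _,_; Σ; ∃-syntax)
open import Data.Maybe using (Maybe; just; nothing)
open import Relation.Binary.PropositionalEquality using (_≡_)
open import Relation.Nullary using (¬_)

-- Terms of k[x₁,x₂,x₃]: x₁^a x₂^b x₃^c is represented by (a , b , c).
Term : Set
Term = ℕ × ℕ × ℕ

sumBelow : ℕ → (ℕ → ℕ) → ℕ
sumBelow zero    f = 0
sumBelow (suc n) f = sumBelow n f + f n

-- τ / min(τ), where min(τ) is the smallest variable (x₁<x₂<x₃) dividing τ;
-- undefined (nothing) for τ = 1.
divMin : Term → Maybe Term
divMin (suc a , b     , c    ) = just (a , b , c)
divMin (zero  , suc b , c    ) = just (zero , b , c)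
divMin (zero  , zero  , suc c) = just (zero , zero , c)
divMin (zero  , zero  , zero ) = nothing

-- Star set F(J) of a monomial ideal J, given by its set N(J) of terms not in J.
StarSet : (Term → Set) → Term → Set
StarSet N γ = ¬ N γ × (∃[ δ ] (divMin γ ≡ just δ × N δ))

-- β ∈ I_(h,k), with β given 0-indexed: β 0 > β 1 > ... > β (k-1) > 0, Σ β = h.
InI : ℕ → ℕ → (ℕ → ℕ) → Set
InI h k β =
  (∀ i → suc i < k → β (suc i) < β i) ×
  (∀ i → i < k → 0 < β i) ×
  sumBelow k β ≡ h

-- ρ ∈ P_(p,h,k),β, 0-indexed: entries ρ i j for i < k, j < β i.
InP : ℕ → ℕ → ℕ → (ℕ → ℕ) → (ℕ → ℕ → ℕ) → Set
InP p h k β ρ =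
  (∀ i j → i < k → j < β i → 0 < ρ i j) ×
  (∀ i j → i < k → suc j < β i → ρ i (suc j) < ρ i j) ×
  (∀ i j → suc i < k → j < β (suc i) → ρ (suc i) j < ρ i j) ×
  sumBelow k (λ i → sumBelow (β i) (ρ i)) ≡ p

Nρ : ℕ → (ℕ → ℕ) → (ℕ → ℕ → ℕ) → Term → Set
Nρ k β ρ (a , b , c) = c < k × b < β c × a < ρ c b

-- Write N for the staircase N_ρ. Every term of N has the form x₁^a x₂^j x₃^i with
-- i < k, j < β_i, a < ρ_{i,j}, and positivity of β and ρ makes x₂^j x₃^i ∈ N for
-- i < k, j < β_i, and x₃^i ∈ N for i < k. A star term γ ∉ N with γ / min(γ) ∈ N
-- therefore has exactly one coordinate sitting one past its bound in N: if x₁ ∣ γ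
-- this is the x₁-exponent ρ_{i,j}; otherwise, if x₂ ∣ γ, the x₂-exponent β_i; and
-- otherwise the x₃-exponent k. Conversely each such corner leaves N while its
-- quotient by min stays in N.
module Submission where

open import Defs
open import Data.Nat using (ℕ; zero; suc; pred; _<_)
open import Data.Nat.Properties using (<-irrefl; ≤∧≮⇒≡; n<1+n)
open import Data.Product using (_×_; _,_; ∃-syntax)
open import Data.Sum using (_⊎_; inj₁; inj₂)
open import Data.Maybe using (just)
open import Relation.Nullary using (¬_)
open import Relation.Binary.PropositionalEquality using (_≡_; refl; cong)
open import Function.Bundles using (_⇔_; mk⇔)

pred<self : ∀ {n} → 0 < n → pred n < n
pred<self {suc n} _ = n<1+n n

divMin-x₁ : ∀ {a b c} → 0 < a → divMin (a , b , c) ≡ just (pred a , b , c)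
divMin-x₁ {suc a} _ = refl

divMin-x₂ : ∀ {b c} → 0 < b → divMin (0 , b , c) ≡ just (0 , pred b , c)
divMin-x₂ {suc b} _ = refl

divMin-x₃ : ∀ {c} → 0 < c → divMin (0 , 0 , c) ≡ just (0 , 0 , pred c)
divMin-x₃ {suc c} _ = refl

Corner : ℕ → (ℕ → ℕ) → (ℕ → ℕ → ℕ) → Term → Set
Corner k β ρ γ =
  γ ≡ (0 , 0 , k)
  ⊎ (∃[ i ] (i < k × γ ≡ (0 , β i , i)))
  ⊎ (∃[ i ] ∃[ j ] (i < k × j < β i × γ ≡ (ρ i j , j , i)))

module Staircase {k : ℕ} {β : ℕ → ℕ} {ρ : ℕ → ℕ → ℕ}
  (β-pos : ∀ i → i < k → 0 < β i)
  (ρ-pos : ∀ i j → i < k → j < β i → 0 < ρ i j) where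

  N : Term → Set
  N = Nρ k β ρ

  Nρ-x₂x₃ : ∀ {b c} → c < k → b < β c → N (0 , b , c)
  Nρ-x₂x₃ {b} {c} c<k b<β = c<k , b<β , ρ-pos c b c<k b<β

  Nρ-x₃ : ∀ {c} → c < k → N (0 , 0 , c)
  Nρ-x₃ {c} c<k = Nρ-x₂x₃ c<k (β-pos c c<k)

  ∉Nρ-x₁-bound : ∀ {b c} → ¬ N (ρ c b , b , c)
  ∉Nρ-x₁-bound (_ , _ , ρ<ρ) = <-irrefl refl ρ<ρ

  ∉Nρ-x₂-bound : ∀ {a c} → ¬ N (a , β c , c)
  ∉Nρ-x₂-bound (_ , β<β , _) = <-irrefl refl β<β

  ∉Nρ-x₃-bound : ∀ {a b} → ¬ N (a , b , k)
  ∉Nρ-x₃-bound (k<k , _) = <-irrefl refl k<k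

  -- In each case the quotient γ / min(γ) lies in N at some coordinate m < n,
  -- while γ ∉ N forces ¬ (suc m < n); hence suc m ≡ n.
  star⇒corner : ∀ γ → StarSet N γ → Corner k β ρ γ
  star⇒corner (suc a , b , c) (γ∉N , _ , refl , c<k , b<β , a<ρ) =
    inj₂ (inj₂ (c , b , c<k , b<β , cong (_, b , c)
      (≤∧≮⇒≡ a<ρ λ a+1<ρ → γ∉N (c<k , b<β , a+1<ρ))))
  star⇒corner (zero , suc b , c) (γ∉N , _ , refl , c<k , b<β , _) =
    inj₂ (inj₁ (c , c<k , cong (λ n → 0 , n , c)
      (≤∧≮⇒≡ b<β λ b+1<β → γ∉N (Nρ-x₂x₃ c<k b+1<β))))
  star⇒corner (zero , zero , suc c) (γ∉N , _ , refl , c<k , _) =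
    inj₁ (cong (λ n → 0 , 0 , n)
      (≤∧≮⇒≡ c<k λ c+1<k → γ∉N (Nρ-x₃ c+1<k)))
  star⇒corner (zero , zero , zero) (_ , _ , () , _)

  corner⇒star : 0 < k → ∀ γ → Corner k β ρ γ → StarSet N γ
  corner⇒star 0<k _ (inj₁ refl) =
    ∉Nρ-x₃-bound , _ , divMin-x₃ 0<k , Nρ-x₃ (pred<self 0<k)
  corner⇒star _ _ (inj₂ (inj₁ (i , i<k , refl))) =
    ∉Nρ-x₂-bound , _ , divMin-x₂ β>0 , Nρ-x₂x₃ i<k (pred<self β>0)
    where β>0 = β-pos i i<k
  corner⇒star _ _ (inj₂ (inj₂ (i , j , i<k , j<β , refl))) =
    ∉Nρ-x₁-bound , _ , divMin-x₁ ρ>0 , i<k , j<β , pred<self ρ>0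
    where ρ>0 = ρ-pos i j i<k j<β

mainTheorem11 : (p h k : ℕ) → 0 < p → 0 < h → 0 < k →
    (β : ℕ → ℕ) → InI h k β →
    (ρ : ℕ → ℕ → ℕ) → InP p h k β ρ →
    (γ : Term) →
    StarSet (Nρ k β ρ) γ ⇔
      (γ ≡ (0 , 0 , k)
       ⊎ (∃[ i ] (i < k × γ ≡ (0 , β i , i)))
       ⊎ (∃[ i ] ∃[ j ] (i < k × j < β i × γ ≡ (ρ i j , j , i))))
mainTheorem11 _ _ _ _ _ 0<k β (_ , β-pos , _) ρ (ρ-pos , _) γ =
  mk⇔ (star⇒corner γ) (corner⇒star 0<k γ)
  where open Staircase β-pos ρ-pos
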